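{- Let $G=(V,E,e)$ be a finite connected rooted graph and, for the free power $G^{*n}$, define: $D_n$ the diagonal matrix of vertex degrees of $G^{*n}$; $\Delta_n$ the matrix with $(\Delta_n)_{ij}$ the number of triangles of $G^{*n}$ having $\{i,j\}$ as a side; $\tilde A^{[2]}_n$ the matrix with $(\tilde A^{[2]}_n)_{ij}$ the number of paths of length $2$ from $i$ to $j$ if $i,j$ are at distance $2$ in $G^{*n}$, and $0$ otherwise. Then the mixed moments, with respect to the vacuum state, of the pair $(\tilde A^{[2]}_n/n,\ \Delta_n/n)$ and of the pair $(D_n/n,\ \Delta_n/n)$ asymptotically vanish as $n\to\infty$.
   Context: Free power: let $V^0=V\setminus\{e\}$. The vertices of $G^{*n}$ are the empty word (the root, denoted $e$) and all finite words $(v_1,i_1)\cdots(v_m,i_m)$ with $v_r\in V^0$, $i_r\in\{1,\dots,n\}$, $i_r\neq i_{r+1}$. For $i\in\{1,\dots,n\}$, a word $u$ whose first letter (if any) does not have index $i$, and $w\in V$, let $w\cdot_i u$ be $(w,i)u$ if $w\in V^0$ and $u$ if $w=e$; vertices $x,y$ are adjacent iff $x=v\cdot_i u$, $y=v'\cdot_i u$ for some such $i,u$ and some edge $\{v,v'\}\in E$. The vacuum state is $\varphi_1(M)=M_{ee}$. "The mixed moments of $(X_n,Y_n)$ asymptotically vanish" means: $\varphi_1(W_n)\to0$ for every finite product $W_n$ of factors equal to $X_n$ or $Y_n$ in which both occur. -}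

module Defs where

open import Data.Nat using (ℕ; zero; suc; NonZero) renaming (_+_ to _+ℕ_; _*_ to _*ℕ_; _≤_ to _≤ℕ_)
open import Data.Fin using (Fin) renaming (_≟_ to _≟F_)
open import Data.Fin.Properties using (all?)
open import Data.Bool using (Bool; true; false; _∧_; _∨_; not; if_then_else_)
open import Data.List using (List; []; _∷_; map; concatMap; filter; length; foldr)
open import Data.List.Membership.Propositional using (_∈_)
open import Data.Product using (_×_; _,_; ∃-syntax; Σ-syntax)
import Data.Product.Properties as ×P
import Data.List.Properties as LP
open import Data.Integer using (+_)
open import Data.Rational using (ℚ; 0ℚ; 1ℚ; _+_; _*_; _<_; ∣_∣; _/_)
open import Relation.Nullary using (¬_; ⌊_⌋)
open import Relation.Nullary.Decidable using (Dec; yes; no)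
open import Relation.Binary.PropositionalEquality using (_≡_; _≢_)

record RootedGraph : Set where
  field
    k     : ℕ
    root  : Fin k
    edge  : Fin k → Fin k → Bool
    sym   : ∀ u v → edge u v ≡ edge v u
    irrefl : ∀ v → edge v v ≡ false

data Reach (G : RootedGraph) : Fin (RootedGraph.k G) → Fin (RootedGraph.k G) → Set where
  here : ∀ {u} → Reach G u u
  step : ∀ {u v w} → RootedGraph.edge G u v ≡ true → Reach G v w → Reach G u w

Connected : RootedGraph → Set
Connected G = ∀ u v → Reach G u v

-- A letter is a pair (v , i) with v ∈ V, i ∈ {1..n}
-- (encoded as Fin n); a vertex is a word of letters with v ≠ e and
-- consecutive indices distinct; the empty word [] is the root.

module FreePower (G : RootedGraph) (n : ℕ) where
  open RootedGraph G

  Letter : Set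
  Letter = Fin k × Fin n

  Word : Set
  Word = List Letter

  _==_ : Word → Word → Bool
  x == y = ⌊ LP.≡-dec (×P.≡-dec _≟F_ _≟F_) x y ⌋

  _=F=_ : ∀ {m} → Fin m → Fin m → Bool
  a =F= b = ⌊ a ≟F b ⌋

  valid : Word → Bool
  valid [] = true
  valid ((v , i) ∷ []) = not (v =F= root)
  valid ((v , i) ∷ ((v' , j) ∷ u)) =
    not (v =F= root) ∧ not (i =F= j) ∧ valid ((v' , j) ∷ u)

  letters : List Letter
  letters = concatMap (λ v → map (λ i → (v , i)) (Data.List.allFin n)) (Data.List.allFin k)

  lists : ℕ → List Word
  lists zero = [] ∷ []
  lists (suc L) = [] ∷ concatMap (λ a → map (a ∷_) (lists L)) letters

  verts : ℕ → List Word
  verts L = filter (λ w → Data.Bool.T? (valid w)) (lists L)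

  -- adjacency of G^{*n}: x ~ y iff x = v ·_i u, y = v' ·_i u with {v,v'} ∈ E.
  -- Case analysis of this definition on the shapes of x and y.
  adj : Word → Word → Bool
  adj [] [] = false
  adj ((v , i) ∷ u) [] = (u == []) ∧ edge v root
  adj [] ((v' , j) ∷ u') = (u' == []) ∧ edge root v'
  adj ((v , i) ∷ u) ((v' , j) ∷ u') =
       ((i =F= j) ∧ (u == u') ∧ edge v v')
     ∨ ((u == ((v' , j) ∷ u')) ∧ edge v root)
     ∨ ((((v , i) ∷ u) == u') ∧ edge root v')

  count : {A : Set} → (A → Bool) → List A → ℕ
  count p [] = 0
  count p (a ∷ as) = if p a then suc (count p as) else count p as

  -- every neighbour of x has length ≤ length x + 1, so neighbours of x
  -- are enumerated exactly by  verts (suc (length x)).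
  nbhd : Word → List Word
  nbhd x = verts (suc (length x))

  common : Word → Word → ℕ
  common x y = count (λ z → adj x z ∧ adj z y) (nbhd x)

  Dmat : Word → Word → ℕ
  Dmat x y = if x == y then count (adj x) (nbhd x) else 0

  Δmat : Word → Word → ℕ
  Δmat x y = if adj x y then common x y else 0

  -- Ã^[2]_n : number of paths of length 2 from x to y if d(x,y) = 2, else 0
  -- (d(x,y) = 2  iff  x ≠ y, x ≁ y and x,y have a common neighbour;
  --  if no common neighbour the count is 0 anyway)
  A2mat : Word → Word → ℕ
  A2mat x y = if not (x == y) ∧ not (adj x y) then common x y else 0

ℕtoℚ : ℕ → ℚ
ℕtoℚ c = + c / 1

-- 1/n (for n = 0 we put 0; irrelevant for n → ∞)
inv : ℕ → ℚ
inv zero = 0ℚ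
inv (suc m) = + 1 / suc m

Matrix : Set → Set
Matrix W = W → W → ℚ

sumℚ : {A : Set} → (A → ℚ) → List A → ℚ
sumℚ f = foldr (λ a acc → f a + acc) 0ℚ

module Moments (G : RootedGraph) (n : ℕ) where
  open FreePower G n

  scaled : (Word → Word → ℕ) → Matrix Word
  scaled M x y = ℕtoℚ (M x y) * inv n

  -- vacuum state of a product M₁ M₂ ⋯ Mₘ:
  --   φ₁(M₁⋯Mₘ) = (M₁⋯Mₘ)_{ee} = Σ_{x₁,…,x_{m-1}} (M₁)_{e x₁} (M₂)_{x₁ x₂} ⋯ (Mₘ)_{x_{m-1} e}.
  -- All matrices considered are supported on pairs at graph distance ≤ 2,
  -- and a step of G^{*n} changes word length by ≤ 1, so every intermediate
  -- vertex x_j has length ≤ 2m: the sums range over  verts (2m), which is exact.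
  propagate : List Word → (Word → ℚ) → List (Matrix Word) → (Word → ℚ)
  propagate S v [] = v
  propagate S v (M ∷ Ms) = propagate S (λ y → sumℚ (λ x → v x * M x y) S) Ms

  δe : Word → ℚ
  δe x = if x == [] then 1ℚ else 0ℚ

  φ₁ : List (Matrix Word) → ℚ
  φ₁ Ms = propagate (verts (2 *ℕ length Ms)) δe Ms []

TendsToZero : (ℕ → ℚ) → Set
TendsToZero f = ∀ (ε : ℚ) → 0ℚ < ε → ∃[ N ] (∀ n → N ≤ℕ n → ∣ f n ∣ < ε)

choose : {A : Set} → A → A → Bool → A
choose X Y true = X
choose X Y false = Y

MixedMomentsVanish : (G : RootedGraph)
  → (X Y : (n : ℕ) → FreePower.Word G n → FreePower.Word G n → ℕ) → Set
MixedMomentsVanish G X Y =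
  ∀ (w : List Bool) → true ∈ w → false ∈ w →
    TendsToZero (λ n → Moments.φ₁ G n
      (map (choose (Moments.scaled G n (X n)) (Moments.scaled G n (Y n))) w))

-- Let k = |V| and K = 2k + 1. A vertex of G^{*n} at height h (word length) has at most kn
-- neighbours at height h + 1, at most k at height h and one at height h - 1. Hence Δ_n is
-- supported on edges with entries at most K (the third vertex of a triangle on an edge {x,y}
-- is a relative of x adjacent to y), D_n ≤ K n on the diagonal, and Ã²_n ≤ A_n² entrywise.
-- Give Δ_n the budget 1 and D_n, Ã²_n the budget 2. Along a product M₁⋯Mⱼ, the root row has
-- entries at most K^{2j} n^{⌊(s-h)/2⌋} at height h ≤ s and 0 above s, where s is the budget
-- spent: collecting mass from the kn children of a vertex costs a factor n, paid for by one
-- unit of budget together with the unit of height gained. At the root, the moment of a word of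
-- length m is at most K^{2m} n^{⌊S/2⌋} / n^m with total budget S ≤ 2m - 1 as soon as Δ_n
-- occurs, so it is O(1/n).

module Submission where

open import Defs
open import Data.Bool using (Bool; true; false; _∧_; _∨_; not; T?)
open import Data.Empty using (⊥-elim)
open import Data.Fin using (Fin) renaming (zero to fz; suc to fs; _≟_ to _≟F_)
open import Data.List using (List; []; _∷_; map; concatMap; filter; length; _++_; allFin)
open import Data.List.Membership.Propositional using (_∈_)
open import Data.List.Relation.Unary.Any using (here; there)
import Data.List.Properties as List
open import Data.Nat using (ℕ; zero; suc; _+_; _*_; _∸_; _^_; _≤_; _<_; z≤n; s≤s; ⌊_/2⌋)
open import Data.Nat.Properties
open import Data.Nat.Tactic.RingSolver using (solve-∀)
open import Algebra.Properties.CommutativeSemigroup *-commutativeSemigroup using (x∙yz≈y∙xz)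
open import Data.Product using (_×_; _,_; proj₁; proj₂)
open import Data.Sum using (_⊎_; inj₁; inj₂)
open import Function using (_∘_)
open import Level using (0ℓ)
open import Relation.Nullary using (¬_; Dec; yes; no; ⌊_⌋; does)
open import Relation.Unary using (Pred; Decidable)
open import Relation.Binary.PropositionalEquality
import Data.Integer as ℤ
import Data.Integer.Properties as ℤP
open import Data.Rational as ℚ using (ℚ; 0ℚ; 1ℚ; toℚᵘ)
  renaming (_+_ to _+ℚ_; _*_ to _*ℚ_; _≤_ to _≤ℚ_; _<_ to _<ℚ_)
import Data.Rational.Properties as ℚP
open import Data.Rational.Unnormalised as ℚᵘ using (mkℚᵘ; _≃_; *≡*; *≤*; *<*)
import Data.Rational.Unnormalised.Properties as ℚᵘP
open import Data.Rational.Solver using (module +-*-Solver)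

-- Finite sums

∑ : {A : Set} → (A → ℕ) → List A → ℕ
∑ f [] = 0
∑ f (a ∷ as) = f a + ∑ f as

module _ {A : Set} where

  ∑-cong : {f g : A → ℕ} (xs : List A) → (∀ x → f x ≡ g x) → ∑ f xs ≡ ∑ g xs
  ∑-cong [] f≗g = refl
  ∑-cong (x ∷ xs) f≗g = cong₂ _+_ (f≗g x) (∑-cong xs f≗g)

  ∑-mono : {f g : A → ℕ} (xs : List A) → (∀ x → f x ≤ g x) → ∑ f xs ≤ ∑ g xs
  ∑-mono [] f≤g = z≤n
  ∑-mono (x ∷ xs) f≤g = +-mono-≤ (f≤g x) (∑-mono xs f≤g)

  ∑-zero : (xs : List A) → ∑ (λ _ → 0) xs ≡ 0
  ∑-zero [] = refl
  ∑-zero (x ∷ xs) = ∑-zero xs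

  ∑-+ : (f g : A → ℕ) (xs : List A) → ∑ (λ x → f x + g x) xs ≡ ∑ f xs + ∑ g xs
  ∑-+ f g [] = refl
  ∑-+ f g (x ∷ xs) = trans (cong (f x + g x +_) (∑-+ f g xs)) (interchange (f x) (g x) (∑ f xs) (∑ g xs))
    where
    interchange : ∀ a b c d → a + b + (c + d) ≡ a + c + (b + d)
    interchange = solve-∀

  ∑-*ˡ : (c : ℕ) (f : A → ℕ) (xs : List A) → ∑ (λ x → c * f x) xs ≡ c * ∑ f xs
  ∑-*ˡ c f [] = sym (*-zeroʳ c)
  ∑-*ˡ c f (x ∷ xs) = trans (cong (c * f x +_) (∑-*ˡ c f xs)) (sym (*-distribˡ-+ c (f x) (∑ f xs)))

  ∑-*ʳ : (c : ℕ) (f : A → ℕ) (xs : List A) → ∑ (λ x → f x * c) xs ≡ ∑ f xs * c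
  ∑-*ʳ c f xs = trans (∑-cong xs (λ x → *-comm (f x) c)) (trans (∑-*ˡ c f xs) (*-comm c (∑ f xs)))

  ∑-++ : (f : A → ℕ) (xs ys : List A) → ∑ f (xs ++ ys) ≡ ∑ f xs + ∑ f ys
  ∑-++ f [] ys = refl
  ∑-++ f (x ∷ xs) ys = trans (cong (f x +_) (∑-++ f xs ys)) (sym (+-assoc (f x) _ _))

  ∑-filter : {P : Pred A 0ℓ} (P? : Decidable P) (f : A → ℕ) (xs : List A) → ∑ f (filter P? xs) ≤ ∑ f xs
  ∑-filter P? f [] = z≤n
  ∑-filter P? f (x ∷ xs) with does (P? x)
  ... | true = +-monoʳ-≤ (f x) (∑-filter P? f xs)
  ... | false = ≤-trans (∑-filter P? f xs) (m≤n+m _ (f x))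

module _ {A B : Set} where

  ∑-map : (f : B → ℕ) (g : A → B) (xs : List A) → ∑ f (map g xs) ≡ ∑ (f ∘ g) xs
  ∑-map f g [] = refl
  ∑-map f g (x ∷ xs) = cong (f (g x) +_) (∑-map f g xs)

  ∑-concatMap : (f : B → ℕ) (g : A → List B) (xs : List A) → ∑ f (concatMap g xs) ≡ ∑ (λ a → ∑ f (g a)) xs
  ∑-concatMap f g [] = refl
  ∑-concatMap f g (x ∷ xs) = trans (∑-++ f (g x) (concatMap g xs)) (cong (∑ f (g x) +_) (∑-concatMap f g xs))

  ∑-comm : (F : A → B → ℕ) (xs : List A) (ys : List B) →
    ∑ (λ x → ∑ (F x) ys) xs ≡ ∑ (λ y → ∑ (λ x → F x y) xs) ys
  ∑-comm F [] ys = sym (∑-zero ys)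
  ∑-comm F (x ∷ xs) ys = trans (cong (∑ (F x) ys +_) (∑-comm F xs ys)) (sym (∑-+ (F x) _ ys))

∑-const : {A : Set} (c : ℕ) (xs : List A) → ∑ (λ _ → c) xs ≡ length xs * c
∑-const c [] = refl
∑-const c (x ∷ xs) = cong (c +_) (∑-const c xs)

∑-+₃ : {A : Set} (f g h : A → ℕ) (xs : List A) → ∑ (λ x → f x + g x + h x) xs ≡ ∑ f xs + ∑ g xs + ∑ h xs
∑-+₃ f g h xs = trans (∑-+ (λ x → f x + g x) h xs) (cong (_+ ∑ h xs) (∑-+ f g xs))

∑-*-≤ : {A : Set} (c : ℕ) {f : A → ℕ} (xs : List A) → ∑ f xs ≤ 1 → ∑ (λ x → c * f x) xs ≤ c
∑-*-≤ c {f} xs ∑f≤1 = begin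
  ∑ (λ x → c * f x) xs  ≡⟨ ∑-*ˡ c f xs ⟩
  c * ∑ f xs            ≤⟨ *-monoʳ-≤ c ∑f≤1 ⟩
  c * 1                 ≡⟨ *-identityʳ c ⟩
  c                     ∎
  where open ≤-Reasoning

𝟙 : Bool → ℕ
𝟙 true = 1
𝟙 false = 0

𝟙≤1 : ∀ b → 𝟙 b ≤ 1
𝟙≤1 true = ≤-refl
𝟙≤1 false = z≤n

𝟙-∧ : ∀ a b → 𝟙 (a ∧ b) ≡ 𝟙 a * 𝟙 b
𝟙-∧ true b = sym (+-identityʳ (𝟙 b))
𝟙-∧ false b = refl

𝟙-mono : ∀ {a b} → (a ≡ true → b ≡ true) → 𝟙 a ≤ 𝟙 b
𝟙-mono {true} a⇒b rewrite a⇒b refl = ≤-refl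
𝟙-mono {false} a⇒b = z≤n

𝟙-*-mono : ∀ b {u c} → (b ≡ true → u ≤ c) → 𝟙 b * u ≤ 𝟙 b * c
𝟙-*-mono true u≤c = *-monoʳ-≤ 1 (u≤c refl)
𝟙-*-mono false u≤c = z≤n

∧-elim : ∀ a {b} → a ∧ b ≡ true → a ≡ true × b ≡ true
∧-elim true b≡true = refl , b≡true

∨-elim : ∀ {a b} → a ∨ b ≡ true → a ≡ true ⊎ b ≡ true
∨-elim {true} _ = inj₁ refl
∨-elim {false} b≡true = inj₂ b≡true

⌊⌋-sound : {P : Set} (d : Dec P) → ⌊ d ⌋ ≡ true → P
⌊⌋-sound (yes p) _ = p

⌊⌋-refl : {A : Set} {x : A} (d : Dec (x ≡ x)) → ⌊ d ⌋ ≡ true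
⌊⌋-refl (yes _) = refl
⌊⌋-refl (no x≢x) = ⊥-elim (x≢x refl)

∑-allFin-suc : ∀ {m} (f : Fin (suc m) → ℕ) → ∑ f (allFin (suc m)) ≡ f fz + ∑ (f ∘ fs) (allFin m)
∑-allFin-suc {m} f =
  cong (f fz +_) (trans (cong (∑ f) (sym (List.map-tabulate (λ i → i) fs))) (∑-map f fs (allFin m)))

∑-allFin-const : ∀ m (c : ℕ) → ∑ (λ _ → c) (allFin m) ≡ m * c
∑-allFin-const m c = trans (∑-const c (allFin m)) (cong (_* c) (List.length-tabulate {n = m} (λ i → i)))

count-allFin-≡ : ∀ {m} (j : Fin m) → ∑ (λ i → 𝟙 ⌊ i ≟F j ⌋) (allFin m) ≤ 1
count-allFin-≡ {suc m} fz =
  ≤-reflexive (trans (∑-allFin-suc {m} (λ i → 𝟙 ⌊ i ≟F fz ⌋)) (cong suc (∑-zero (allFin m))))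
count-allFin-≡ {suc m} (fs j) = begin
  ∑ (λ i → 𝟙 ⌊ i ≟F fs j ⌋) (allFin (suc m))  ≡⟨ ∑-allFin-suc (λ i → 𝟙 ⌊ i ≟F fs j ⌋) ⟩
  ∑ (λ i → 𝟙 ⌊ fs i ≟F fs j ⌋) (allFin m)      ≡⟨ ∑-cong (allFin m) (λ i → cong 𝟙 (⌊fs≟fs⌋ i j)) ⟩
  ∑ (λ i → 𝟙 ⌊ i ≟F j ⌋) (allFin m)            ≤⟨ count-allFin-≡ j ⟩
  1                                            ∎
  where
  open ≤-Reasoning
  ⌊fs≟fs⌋ : ∀ (i j : Fin m) → ⌊ fs i ≟F fs j ⌋ ≡ ⌊ i ≟F j ⌋
  ⌊fs≟fs⌋ i j with i ≟F j
  ... | yes _ = refl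
  ... | no _ = refl

-- Counting words of the free power

K : RootedGraph → ℕ
K G = let open RootedGraph G in k + k + 1

module Enumeration (G : RootedGraph) (n : ℕ) where
  open RootedGraph G hiding (sym)
  open FreePower G n

  count≡∑𝟙 : {A : Set} (p : A → Bool) (xs : List A) → count p xs ≡ ∑ (𝟙 ∘ p) xs
  count≡∑𝟙 p [] = refl
  count≡∑𝟙 p (a ∷ as) with p a
  ... | true = cong suc (count≡∑𝟙 p as)
  ... | false = count≡∑𝟙 p as

  ∑-verts≤∑-lists : ∀ L (f : Word → ℕ) → ∑ f (verts L) ≤ ∑ f (lists L)
  ∑-verts≤∑-lists L f = ∑-filter (λ w → T? (valid w)) f (lists L)

  =F=-sound : ∀ {m} (i j : Fin m) → i =F= j ≡ true → i ≡ j
  =F=-sound i j = ⌊⌋-sound (i ≟F j)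

  =F=-refl : ∀ {m} (i : Fin m) → i =F= i ≡ true
  =F=-refl i = ⌊⌋-refl (i ≟F i)

  ==-sound : ∀ x y → x == y ≡ true → x ≡ y
  ==-sound x y = ⌊⌋-sound (List.≡-dec _ x y)

  ==-refl : ∀ x → x == x ≡ true
  ==-refl x = ⌊⌋-refl (List.≡-dec _ x x)

  ∑-letters : (f : Letter → ℕ) → ∑ f letters ≡ ∑ (λ v → ∑ (λ i → f (v , i)) (allFin n)) (allFin k)
  ∑-letters f = trans (∑-concatMap f (λ v → map (v ,_) (allFin n)) (allFin k))
                      (∑-cong (allFin k) (λ v → ∑-map f (v ,_) (allFin n)))

  ∑-lists-suc : ∀ L (f : Word → ℕ) → ∑ f (lists (suc L)) ≡ f [] + ∑ (λ a → ∑ (f ∘ (a ∷_)) (lists L)) letters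
  ∑-lists-suc L f = cong (f [] +_) (trans (∑-concatMap f (λ a → map (a ∷_) (lists L)) letters)
                                           (∑-cong letters (λ a → ∑-map f (a ∷_) (lists L))))

  ∑-letters-const : ∀ c → ∑ (λ _ → c) letters ≡ k * (n * c)
  ∑-letters-const c = begin
    ∑ (λ _ → c) letters                         ≡⟨ ∑-letters (λ _ → c) ⟩
    ∑ (λ _ → ∑ (λ _ → c) (allFin n)) (allFin k)  ≡⟨ ∑-cong (allFin k) (λ _ → ∑-allFin-const n c) ⟩
    ∑ (λ _ → n * c) (allFin k)                  ≡⟨ ∑-allFin-const k (n * c) ⟩
    k * (n * c)                                 ∎
    where open ≡-Reasoning

  sameLetter : Letter → Letter → Bool
  sameLetter (v , i) (v' , i') = (v =F= v') ∧ (i =F= i')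

  count-sameLetter : ∀ b → ∑ (λ a → 𝟙 (sameLetter a b)) letters ≤ 1
  count-sameLetter (v' , i') = begin
    ∑ (λ a → 𝟙 (sameLetter a (v' , i'))) letters
      ≡⟨ ∑-letters (λ a → 𝟙 (sameLetter a (v' , i'))) ⟩
    ∑ (λ v → ∑ (λ i → 𝟙 ((v =F= v') ∧ (i =F= i'))) (allFin n)) (allFin k)
      ≡⟨ ∑-cong (allFin k) (λ v → trans (∑-cong (allFin n) (λ i → 𝟙-∧ (v =F= v') (i =F= i')))
                                        (∑-*ˡ (𝟙 (v =F= v')) (λ i → 𝟙 (i =F= i')) (allFin n))) ⟩
    ∑ (λ v → 𝟙 (v =F= v') * ∑ (λ i → 𝟙 (i =F= i')) (allFin n)) (allFin k)
      ≤⟨ ∑-mono (allFin k) (λ v → *-monoʳ-≤ (𝟙 (v =F= v')) (count-allFin-≡ i')) ⟩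
    ∑ (λ v → 𝟙 (v =F= v') * 1) (allFin k)
      ≡⟨ ∑-cong (allFin k) (λ v → *-identityʳ (𝟙 (v =F= v'))) ⟩
    ∑ (λ v → 𝟙 (v =F= v')) (allFin k)
      ≤⟨ count-allFin-≡ v' ⟩
    1 ∎
    where open ≤-Reasoning

  ∷==∷⇒ : ∀ a w b u → (a ∷ w) == (b ∷ u) ≡ true → sameLetter a b ∧ (w == u) ≡ true
  ∷==∷⇒ (v , i) w b u eq with ==-sound ((v , i) ∷ w) (b ∷ u) eq
  ... | refl rewrite =F=-refl v | =F=-refl i = ==-refl w

  count-== : ∀ L u → ∑ (λ x → 𝟙 (x == u)) (lists L) ≤ 1
  count-== zero u = +-monoˡ-≤ 0 (𝟙≤1 ([] == u))
  count-== (suc L) [] = ≤-reflexive (trans (∑-lists-suc L (λ x → 𝟙 (x == [])))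
    (cong suc (trans (∑-cong letters (λ _ → ∑-zero (lists L))) (∑-zero letters))))
  count-== (suc L) (b ∷ u) = begin
    ∑ (λ x → 𝟙 (x == (b ∷ u))) (lists (suc L))
      ≡⟨ ∑-lists-suc L (λ x → 𝟙 (x == (b ∷ u))) ⟩
    ∑ (λ a → ∑ (λ w → 𝟙 ((a ∷ w) == (b ∷ u))) (lists L)) letters
      ≤⟨ ∑-mono letters (λ a → ∑-mono (lists L) (λ w →
           ≤-trans (𝟙-mono (∷==∷⇒ a w b u)) (≤-reflexive (𝟙-∧ (sameLetter a b) (w == u))))) ⟩
    ∑ (λ a → ∑ (λ w → 𝟙 (sameLetter a b) * 𝟙 (w == u)) (lists L)) letters
      ≤⟨ ∑-mono letters (λ a → ∑-*-≤ (𝟙 (sameLetter a b)) (lists L) (count-== L u)) ⟩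
    ∑ (λ a → 𝟙 (sameLetter a b)) letters
      ≤⟨ count-sameLetter b ⟩
    1 ∎
    where open ≤-Reasoning

  δ[] : Word → ℕ
  δ[] y = 𝟙 (y == [])

  isChild : Word → Word → Bool
  isChild [] y = false
  isChild (_ ∷ x) y = x == y

  isSibling : Word → Word → Bool
  isSibling ((_ , i) ∷ x) ((_ , j) ∷ y) = (i =F= j) ∧ (x == y)
  isSibling _ _ = false

  parent : Word → Word
  parent [] = []
  parent (_ ∷ x) = x

  count-children : ∀ L y → ∑ (λ x → 𝟙 (isChild x y)) (lists L) ≤ k * n
  count-children zero y = z≤n
  count-children (suc L) y = begin
    ∑ (λ x → 𝟙 (isChild x y)) (lists (suc L))  ≡⟨ ∑-lists-suc L (λ x → 𝟙 (isChild x y)) ⟩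
    ∑ (λ _ → ∑ (λ w → 𝟙 (w == y)) (lists L)) letters  ≤⟨ ∑-mono letters (λ _ → count-== L y) ⟩
    ∑ (λ _ → 1) letters                         ≡⟨ ∑-letters-const 1 ⟩
    k * (n * 1)                                 ≡⟨ cong (k *_) (*-identityʳ n) ⟩
    k * n                                       ∎
    where open ≤-Reasoning

  count-index : ∀ j → ∑ (λ a → 𝟙 (proj₂ a =F= j)) letters ≤ k
  count-index j = begin
    ∑ (λ a → 𝟙 (proj₂ a =F= j)) letters              ≡⟨ ∑-letters (λ a → 𝟙 (proj₂ a =F= j)) ⟩
    ∑ (λ _ → ∑ (λ i → 𝟙 (i =F= j)) (allFin n)) (allFin k)  ≤⟨ ∑-mono (allFin k) (λ _ → count-allFin-≡ j) ⟩
    ∑ (λ _ → 1) (allFin k)                            ≡⟨ trans (∑-allFin-const k 1) (*-identityʳ k) ⟩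
    k                                                 ∎
    where open ≤-Reasoning

  count-siblings : ∀ L y → ∑ (λ x → 𝟙 (isSibling x y)) (lists L) ≤ k
  count-siblings zero y = z≤n
  count-siblings (suc L) [] = ≤-trans (≤-reflexive (trans (∑-lists-suc L (λ x → 𝟙 (isSibling x [])))
    (trans (∑-cong letters (λ _ → ∑-zero (lists L))) (∑-zero letters)))) z≤n
  count-siblings (suc L) ((v' , j) ∷ u) = begin
    ∑ (λ x → 𝟙 (isSibling x ((v' , j) ∷ u))) (lists (suc L))
      ≡⟨ ∑-lists-suc L (λ x → 𝟙 (isSibling x ((v' , j) ∷ u))) ⟩
    ∑ (λ a → ∑ (λ w → 𝟙 ((proj₂ a =F= j) ∧ (w == u))) (lists L)) letters
      ≤⟨ ∑-mono letters (λ a →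
           ≤-trans (≤-reflexive (∑-cong (lists L) (λ w → 𝟙-∧ (proj₂ a =F= j) (w == u))))
                   (∑-*-≤ (𝟙 (proj₂ a =F= j)) (lists L) (count-== L u))) ⟩
    ∑ (λ a → 𝟙 (proj₂ a =F= j)) letters
      ≤⟨ count-index j ⟩
    k ∎
    where open ≤-Reasoning

  data Neighbour : Word → Word → Set where
    childOf   : ∀ a y → Neighbour (a ∷ y) y
    siblingOf : ∀ {v v'} i u → edge v v' ≡ true → Neighbour ((v , i) ∷ u) ((v' , i) ∷ u)
    parentOf  : ∀ a x → Neighbour x (a ∷ x)

  adj⇒Neighbour : ∀ x y → adj x y ≡ true → Neighbour x y
  adj⇒Neighbour [] [] ()
  adj⇒Neighbour (a ∷ u) [] e with ==-sound u [] (proj₁ (∧-elim (u == []) e))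
  ... | refl = childOf a []
  adj⇒Neighbour [] (a ∷ u) e with ==-sound u [] (proj₁ (∧-elim (u == []) e))
  ... | refl = parentOf a []
  adj⇒Neighbour ((v , i) ∷ u) ((v' , j) ∷ u') e with ∨-elim e
  ... | inj₁ e₁ with ∧-elim (i =F= j) e₁
  ...   | i=j , rest with ∧-elim (u == u') rest
  ...     | u=u' , edge≡true with =F=-sound i j i=j | ==-sound u u' u=u'
  ...       | refl | refl = siblingOf i u edge≡true
  adj⇒Neighbour ((v , i) ∷ u) ((v' , j) ∷ u') e | inj₂ e₂ with ∨-elim e₂
  ... | inj₁ e₃ with ==-sound u ((v' , j) ∷ u') (proj₁ (∧-elim (u == ((v' , j) ∷ u')) e₃))
  ...   | refl = childOf (v , i) _
  adj⇒Neighbour ((v , i) ∷ u) ((v' , j) ∷ u') e | inj₂ e₂ | inj₂ e₃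
    with ==-sound ((v , i) ∷ u) u' (proj₁ (∧-elim (((v , i) ∷ u) == u') e₃))
  ...   | refl = parentOf (v' , j) _

  Neighbour-sym : ∀ {x y} → Neighbour x y → Neighbour y x
  Neighbour-sym (childOf a y) = parentOf a y
  Neighbour-sym (siblingOf {v} {v'} i u e) = siblingOf i u (trans (RootedGraph.sym G v' v) e)
  Neighbour-sym (parentOf a x) = childOf a x

  relatives : Word → Word → ℕ
  relatives x y = 𝟙 (isChild x y) + 𝟙 (isSibling x y) + 𝟙 (x == parent y)

  Neighbour⇒relative : ∀ {x y} → Neighbour x y → 1 ≤ relatives x y
  Neighbour⇒relative (childOf a y) rewrite ==-refl y = s≤s z≤n
  Neighbour⇒relative (siblingOf {v} {v'} i u _) rewrite =F=-refl i | ==-refl u =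
    ≤-trans (m≤n+m 1 (𝟙 (isChild ((v , i) ∷ u) ((v' , i) ∷ u)))) (m≤m+n _ _)
  Neighbour⇒relative (parentOf a x) rewrite ==-refl x = m≤n+m 1 _

  adj≤relatives : ∀ x y → 𝟙 (adj x y) ≤ relatives x y
  adj≤relatives x y with adj x y in e
  ... | true = Neighbour⇒relative (adj⇒Neighbour x y e)
  ... | false = z≤n

  adj≤relatives′ : ∀ x y → 𝟙 (adj y x) ≤ relatives x y
  adj≤relatives′ x y with adj y x in e
  ... | true = Neighbour⇒relative (Neighbour-sym (adj⇒Neighbour y x e))
  ... | false = z≤n

  ¬Neighbour⇒𝟙adj≡0 : ∀ x y → ¬ Neighbour x y → 𝟙 (adj x y) ≡ 0
  ¬Neighbour⇒𝟙adj≡0 x y ¬x~y with adj x y in e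
  ... | true = ⊥-elim (¬x~y (adj⇒Neighbour x y e))
  ... | false = refl

  ¬Neighbour-grandchild : ∀ a c y → ¬ Neighbour (a ∷ c ∷ y) y
  ¬Neighbour-grandchild a c y ()

  ¬Neighbour-nephew : ∀ a {v v'} i u → edge v v' ≡ true → ¬ Neighbour (a ∷ (v , i) ∷ u) ((v' , i) ∷ u)
  ¬Neighbour-nephew a {v} i u edge≡true (childOf _ _) with trans (sym edge≡true) (irrefl v)
  ... | ()

  Neighbour-cousin⇒sameIndex : ∀ a c x → Neighbour (a ∷ x) (c ∷ x) → proj₂ a =F= proj₂ c ≡ true
  Neighbour-cousin⇒sameIndex _ _ _ (siblingOf i u _) = =F=-refl i

  count-adjacent-extensions : ∀ x y → adj x y ≡ true → ∑ (λ a → 𝟙 (adj (a ∷ x) y)) letters ≤ k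
  count-adjacent-extensions x y e with adj⇒Neighbour x y e
  ... | childOf c _ = ≤-trans (≤-reflexive (trans
          (∑-cong letters (λ a → ¬Neighbour⇒𝟙adj≡0 (a ∷ c ∷ y) y (¬Neighbour-grandchild a c y)))
          (∑-zero letters))) z≤n
  ... | siblingOf i u edge≡true = ≤-trans (≤-reflexive (trans
          (∑-cong letters (λ a → ¬Neighbour⇒𝟙adj≡0 _ _ (¬Neighbour-nephew a i u edge≡true)))
          (∑-zero letters))) z≤n
  ... | parentOf c _ = ≤-trans
          (∑-mono letters (λ a → 𝟙-mono (Neighbour-cousin⇒sameIndex a c x ∘ adj⇒Neighbour (a ∷ x) (c ∷ x))))
          (count-index (proj₂ c))

  count-adjacent-children : ∀ L x y → adj x y ≡ true → ∑ (λ z → 𝟙 (isChild z x) * 𝟙 (adj z y)) (lists L) ≤ k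
  count-adjacent-children zero x y e = z≤n
  count-adjacent-children (suc L) x y e = begin
    ∑ (λ z → 𝟙 (isChild z x) * 𝟙 (adj z y)) (lists (suc L))
      ≡⟨ ∑-lists-suc L (λ z → 𝟙 (isChild z x) * 𝟙 (adj z y)) ⟩
    ∑ (λ a → ∑ (λ w → 𝟙 (w == x) * 𝟙 (adj (a ∷ w) y)) (lists L)) letters
      ≤⟨ ∑-mono letters (λ a → ∑-mono (lists L) (swap a)) ⟩
    ∑ (λ a → ∑ (λ w → 𝟙 (adj (a ∷ x) y) * 𝟙 (w == x)) (lists L)) letters
      ≤⟨ ∑-mono letters (λ a → ∑-*-≤ (𝟙 (adj (a ∷ x) y)) (lists L) (count-== L x)) ⟩
    ∑ (λ a → 𝟙 (adj (a ∷ x) y)) letters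
      ≤⟨ count-adjacent-extensions x y e ⟩
    k ∎
    where
    open ≤-Reasoning
    swap : ∀ a w → 𝟙 (w == x) * 𝟙 (adj (a ∷ w) y) ≤ 𝟙 (adj (a ∷ x) y) * 𝟙 (w == x)
    swap a w with w == x in w=x
    ... | false = z≤n
    ... | true with ==-sound w x w=x
    ...   | refl = ≤-reflexive (*-comm 1 _)

  ∑-relatives : ∀ L y → ∑ (λ x → relatives x y) (lists L) ≤ k * n + k + 1
  ∑-relatives L y = ≤-trans (≤-reflexive (∑-+₃ _ _ _ (lists L)))
    (+-mono-≤ (+-mono-≤ (count-children L y) (count-siblings L y)) (count-== L (parent y)))

  degree-bound : ∀ y → count (adj y) (nbhd y) ≤ k * n + k + 1
  degree-bound y = begin
    count (adj y) (nbhd y)                  ≡⟨ count≡∑𝟙 (adj y) (nbhd y) ⟩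
    ∑ (𝟙 ∘ adj y) (nbhd y)                  ≤⟨ ∑-verts≤∑-lists (suc (length y)) (𝟙 ∘ adj y) ⟩
    ∑ (𝟙 ∘ adj y) (lists (suc (length y)))  ≤⟨ ∑-mono (lists (suc (length y))) (λ z → adj≤relatives′ z y) ⟩
    ∑ (λ z → relatives z y) (lists (suc (length y)))  ≤⟨ ∑-relatives (suc (length y)) y ⟩
    k * n + k + 1                           ∎
    where open ≤-Reasoning

  ∑-lists-mono : ∀ {L L'} (f : Word → ℕ) → L ≤ L' → ∑ f (lists L) ≤ ∑ f (lists L')
  ∑-lists-mono {zero} {zero} f _ = ≤-refl
  ∑-lists-mono {zero} {suc L'} f _ rewrite ∑-lists-suc L' f = +-monoʳ-≤ (f []) z≤n
  ∑-lists-mono {suc L} {suc L'} f (s≤s L≤L') rewrite ∑-lists-suc L f | ∑-lists-suc L' f =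
    +-monoʳ-≤ (f []) (∑-mono letters (λ a → ∑-lists-mono (f ∘ (a ∷_)) L≤L'))

  ∑-lists-mono-short : ∀ L (f g : Word → ℕ) → (∀ x → length x ≤ L → f x ≤ g x) → ∑ f (lists L) ≤ ∑ g (lists L)
  ∑-lists-mono-short zero f g f≤g = +-monoˡ-≤ 0 (f≤g [] z≤n)
  ∑-lists-mono-short (suc L) f g f≤g rewrite ∑-lists-suc L f | ∑-lists-suc L g =
    +-mono-≤ (f≤g [] z≤n) (∑-mono letters (λ a →
      ∑-lists-mono-short L (f ∘ (a ∷_)) (g ∘ (a ∷_)) (λ x |x|≤L → f≤g (a ∷ x) (s≤s |x|≤L))))

  common≤∑ : ∀ L x y → length x < L → common x y ≤ ∑ (λ z → 𝟙 (adj x z) * 𝟙 (adj z y)) (lists L)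
  common≤∑ L x y |x|<L = begin
    common x y                                   ≡⟨ count≡∑𝟙 (λ z → adj x z ∧ adj z y) (nbhd x) ⟩
    ∑ (λ z → 𝟙 (adj x z ∧ adj z y)) (nbhd x)     ≤⟨ ∑-verts≤∑-lists (suc (length x)) _ ⟩
    ∑ (λ z → 𝟙 (adj x z ∧ adj z y)) (lists (suc (length x)))  ≤⟨ ∑-lists-mono _ |x|<L ⟩
    ∑ (λ z → 𝟙 (adj x z ∧ adj z y)) (lists L)    ≡⟨ ∑-cong (lists L) (λ z → 𝟙-∧ (adj x z) (adj z y)) ⟩
    ∑ (λ z → 𝟙 (adj x z) * 𝟙 (adj z y)) (lists L)  ∎
    where open ≤-Reasoning

  triangles-on-edge : ∀ x y → adj x y ≡ true → common x y ≤ K G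
  triangles-on-edge x y e = begin
    common x y
      ≤⟨ common≤∑ L x y ≤-refl ⟩
    ∑ (λ z → 𝟙 (adj x z) * 𝟙 (adj z y)) (lists L)
      ≤⟨ ∑-mono (lists L) through-relatives ⟩
    ∑ (λ z → 𝟙 (isChild z x) * 𝟙 (adj z y) + 𝟙 (isSibling z x) + 𝟙 (z == parent x)) (lists L)
      ≡⟨ ∑-+₃ (λ z → 𝟙 (isChild z x) * 𝟙 (adj z y)) (λ z → 𝟙 (isSibling z x)) (λ z → 𝟙 (z == parent x)) (lists L) ⟩
    _ ≤⟨ +-mono-≤ (+-mono-≤ (count-adjacent-children L x y e) (count-siblings L x)) (count-== L (parent x)) ⟩
    K G ∎
    where
    open ≤-Reasoning
    L = suc (length x)
    through-relatives : ∀ z →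
      𝟙 (adj x z) * 𝟙 (adj z y) ≤ 𝟙 (isChild z x) * 𝟙 (adj z y) + 𝟙 (isSibling z x) + 𝟙 (z == parent x)
    through-relatives z = begin
      𝟙 (adj x z) * t                ≤⟨ *-monoˡ-≤ t (adj≤relatives′ z x) ⟩
      (c + s + p) * t                ≡⟨ distrib c s p t ⟩
      c * t + s * t + p * t          ≤⟨ +-mono-≤ (+-monoʳ-≤ (c * t) (≤-*-𝟙 s)) (≤-*-𝟙 p) ⟩
      c * t + s + p                  ∎
      where
      t = 𝟙 (adj z y)
      c = 𝟙 (isChild z x)
      s = 𝟙 (isSibling z x)
      p = 𝟙 (z == parent x)
      distrib : ∀ c s p t → (c + s + p) * t ≡ c * t + s * t + p * t
      distrib = solve-∀
      ≤-*-𝟙 : ∀ a → a * t ≤ a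
      ≤-*-𝟙 a = ≤-trans (*-monoʳ-≤ a (𝟙≤1 (adj z y))) (≤-reflexive (*-identityʳ a))

  isChild⇒length : ∀ x y → isChild x y ≡ true → length x ≡ suc (length y)
  isChild⇒length (_ ∷ x) y e = cong suc (cong length (==-sound x y e))

  isSibling⇒length : ∀ x y → isSibling x y ≡ true → length x ≡ length y
  isSibling⇒length ((_ , i) ∷ x) ((_ , j) ∷ y) e = cong suc (cong length (==-sound x y (proj₂ (∧-elim (i =F= j) e))))

  ==parent⇒length : ∀ x y → x == parent y ≡ true → length x ≡ length y ∸ 1
  ==parent⇒length x y e = trans (cong length (==-sound x (parent y) e)) (length-parent y)
    where
    length-parent : ∀ y → length (parent y) ≡ length y ∸ 1
    length-parent [] = refl
    length-parent (_ ∷ y) = refl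

  Δmat≤ : ∀ x y → Δmat x y ≤ K G * 𝟙 (adj x y)
  Δmat≤ x y with adj x y in e
  ... | true = ≤-trans (triangles-on-edge x y e) (≤-reflexive (sym (*-identityʳ (K G))))
  ... | false = z≤n

  Dmat≤ : ∀ x y → Dmat x y ≤ 𝟙 (x == y) * (k * n + k + 1)
  Dmat≤ x y with x == y
  ... | true = ≤-trans (degree-bound x) (≤-reflexive (sym (+-identityʳ _)))
  ... | false = z≤n

  A2mat≤common : ∀ x y → A2mat x y ≤ common x y
  A2mat≤common x y with not (x == y) ∧ not (adj x y)
  ... | true = ≤-refl
  ... | false = z≤n

-- Growth of the root row

module _ {W : Set} where

  vecMul : List W → (W → ℕ) → (W → W → ℕ) → W → ℕ
  vecMul S v M y = ∑ (λ x → v x * M x y) S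

  propagateℕ : List W → (W → ℕ) → List (W → W → ℕ) → W → ℕ
  propagateℕ S v [] = v
  propagateℕ S v (M ∷ Ms) = propagateℕ S (vecMul S v M) Ms

budget : List Bool → ℕ
budget = ∑ (choose 2 1)

letterBudget≤2 : ∀ c → choose 2 1 c ≤ 2
letterBudget≤2 true = ≤-refl
letterBudget≤2 false = s≤s z≤n

budget≤ : ∀ w → budget w ≤ length w + length w
budget≤ [] = z≤n
budget≤ (c ∷ w) = ≤-trans (+-mono-≤ (letterBudget≤2 c) (budget≤ w)) (≤-reflexive (cong suc (sym (+-suc _ _))))

budget< : ∀ {w} → false ∈ w → suc (budget w) ≤ length w + length w
budget< {false ∷ w} (here refl) = ≤-trans (s≤s (s≤s (budget≤ w))) (≤-reflexive (cong suc (sym (+-suc _ _))))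
budget< {c ∷ w} (there false∈w) = begin
  suc (choose 2 1 c + budget w)   ≡⟨ +-suc (choose 2 1 c) (budget w) ⟨
  choose 2 1 c + suc (budget w)   ≤⟨ +-mono-≤ (letterBudget≤2 c) (budget< false∈w) ⟩
  2 + (length w + length w)       ≡⟨ cong suc (+-suc _ _) ⟨
  length (c ∷ w) + length (c ∷ w) ∎
  where open ≤-Reasoning

⌊budget/2⌋<length : ∀ {w} → false ∈ w → ⌊ budget w /2⌋ < length w
⌊budget/2⌋<length {w} false∈w =
  ≤-trans (⌊n/2⌋-mono (s≤s (budget< false∈w))) (≤-reflexive (sym (n≡⌈n+n/2⌉ (length w))))

module Growth (G : RootedGraph) (m : ℕ) where
  open RootedGraph G using (k)
  open FreePower G (suc m)
  open Enumeration G (suc m)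

  n : ℕ
  n = suc m

  -- weight s h = n ^ ⌊ (s ∸ h) /2⌋ for h ≤ s, and 0 for h > s.
  weight : ℕ → ℕ → ℕ
  weight s zero = n ^ ⌊ s /2⌋
  weight zero (suc h) = 0
  weight (suc s) (suc h) = weight s h

  weight-parent : ∀ s h → weight s (h ∸ 1) ≤ weight (suc s) h
  weight-parent s zero = ^-monoʳ-≤ n (⌊n/2⌋-mono (n≤1+n s))
  weight-parent s (suc h) = ≤-refl

  weight-sibling : ∀ s h → weight s h ≤ weight (suc s) h
  weight-sibling s zero = ^-monoʳ-≤ n (⌊n/2⌋-mono (n≤1+n s))
  weight-sibling zero (suc h) = z≤n
  weight-sibling (suc s) (suc h) = weight-sibling s h

  weight-loop : ∀ s h → n * weight s h ≤ weight (suc (suc s)) h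
  weight-loop s zero = ≤-refl
  weight-loop zero (suc h) = ≤-trans (≤-reflexive (*-zeroʳ n)) z≤n
  weight-loop (suc s) (suc h) = weight-loop s h

  weight-child : ∀ s h → n * weight s (suc h) ≤ weight (suc s) h
  weight-child zero h = ≤-trans (≤-reflexive (*-zeroʳ n)) z≤n
  weight-child (suc s) h = weight-loop s h

  Bounded : (Word → ℕ) → ℕ → ℕ → Set
  Bounded v C s = ∀ y → v y ≤ C * weight s (length y)

  adjacency-flow : ∀ L {v C s} → Bounded v C s →
    Bounded (λ y → ∑ (λ x → v x * 𝟙 (adj x y)) (lists L)) (K G * C) (suc s)
  adjacency-flow L {v} {C} {s} v≤ y = begin
    ∑ (λ x → v x * 𝟙 (adj x y)) (lists L)
      ≤⟨ ∑-mono (lists L) by-relation ⟩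
    ∑ (λ x → 𝟙 (isChild x y) * A + 𝟙 (isSibling x y) * B + 𝟙 (x == parent y) * D) (lists L)
      ≡⟨ trans (∑-+₃ _ _ _ (lists L))
               (cong₂ _+_ (cong₂ _+_ (∑-*ʳ A _ (lists L)) (∑-*ʳ B _ (lists L))) (∑-*ʳ D _ (lists L))) ⟩
    ∑ (λ x → 𝟙 (isChild x y)) (lists L) * A + ∑ (λ x → 𝟙 (isSibling x y)) (lists L) * B
      + ∑ (λ x → 𝟙 (x == parent y)) (lists L) * D
      ≤⟨ +-mono-≤ (+-mono-≤ (*-monoˡ-≤ A (count-children L y)) (*-monoˡ-≤ B (count-siblings L y)))
                  (*-monoˡ-≤ D (count-== L (parent y))) ⟩
    k * n * A + k * B + 1 * D
      ≡⟨ regroup k n C (weight s (suc h)) B D ⟩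
    k * (C * (n * weight s (suc h))) + k * B + D
      ≤⟨ +-mono-≤ (+-mono-≤ (*-monoʳ-≤ k (*-monoʳ-≤ C (weight-child s h)))
                            (*-monoʳ-≤ k (*-monoʳ-≤ C (weight-sibling s h))))
                  (*-monoʳ-≤ C (weight-parent s h)) ⟩
    k * (C * w) + k * (C * w) + C * w
      ≡⟨ collect k C w ⟩
    K G * C * w ∎
    where
    open ≤-Reasoning
    h = length y
    w = weight (suc s) h
    A = C * weight s (suc h)
    B = C * weight s h
    D = C * weight s (h ∸ 1)
    regroup : ∀ k n C x B D → k * n * (C * x) + k * B + 1 * D ≡ k * (C * (n * x)) + k * B + D
    regroup = solve-∀
    collect : ∀ k C w → k * (C * w) + k * (C * w) + C * w ≡ (k + k + 1) * C * w
    collect = solve-∀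
    bound-at : ∀ x {l} → length x ≡ l → v x ≤ C * weight s l
    bound-at x refl = v≤ x
    by-relation : ∀ x → v x * 𝟙 (adj x y) ≤ 𝟙 (isChild x y) * A + 𝟙 (isSibling x y) * B + 𝟙 (x == parent y) * D
    by-relation x = begin
      v x * 𝟙 (adj x y)
        ≤⟨ *-monoʳ-≤ (v x) (adj≤relatives x y) ⟩
      v x * (𝟙 (isChild x y) + 𝟙 (isSibling x y) + 𝟙 (x == parent y))
        ≡⟨ distrib (v x) (𝟙 (isChild x y)) (𝟙 (isSibling x y)) (𝟙 (x == parent y)) ⟩
      𝟙 (isChild x y) * v x + 𝟙 (isSibling x y) * v x + 𝟙 (x == parent y) * v x
        ≤⟨ +-mono-≤ (+-mono-≤
             (𝟙-*-mono (isChild x y) (bound-at x ∘ isChild⇒length x y))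
             (𝟙-*-mono (isSibling x y) (bound-at x ∘ isSibling⇒length x y)))
             (𝟙-*-mono (x == parent y) (bound-at x ∘ ==parent⇒length x y)) ⟩
      𝟙 (isChild x y) * A + 𝟙 (isSibling x y) * B + 𝟙 (x == parent y) * D ∎
      where
      distrib : ∀ f a b c → f * (a + b + c) ≡ a * f + b * f + c * f
      distrib = solve-∀

  Controlled : ℕ → (Word → Word → ℕ) → Set
  Controlled d M = ∀ L {v C s} → Bounded v C s → Bounded (vecMul (verts L) v M) (K G * (K G * C)) (d + s)

  Δmat-controlled : Controlled 1 Δmat
  Δmat-controlled L {v} {C} {s} v≤ y = begin
    ∑ (λ x → v x * Δmat x y) (verts L)             ≤⟨ ∑-verts≤∑-lists L _ ⟩
    ∑ (λ x → v x * Δmat x y) (lists L)             ≤⟨ ∑-mono (lists L) (λ x → *-monoʳ-≤ (v x) (Δmat≤ x y)) ⟩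
    ∑ (λ x → v x * (K G * 𝟙 (adj x y))) (lists L)  ≡⟨ ∑-cong (lists L) (λ x → x∙yz≈y∙xz (v x) (K G) _) ⟩
    ∑ (λ x → K G * (v x * 𝟙 (adj x y))) (lists L)  ≡⟨ ∑-*ˡ (K G) _ (lists L) ⟩
    K G * ∑ (λ x → v x * 𝟙 (adj x y)) (lists L)    ≤⟨ *-monoʳ-≤ (K G) (adjacency-flow L v≤ y) ⟩
    K G * (K G * C * weight (suc s) (length y))    ≡⟨ *-assoc (K G) (K G * C) _ ⟨
    K G * (K G * C) * weight (suc s) (length y)    ∎
    where open ≤-Reasoning

  degree≤K*n : k * n + k + 1 ≤ K G * n
  degree≤K*n = begin
    k * n + k + 1      ≤⟨ +-mono-≤ (+-monoʳ-≤ (k * n) (m≤m*n k n)) (s≤s z≤n) ⟩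
    k * n + k * n + n  ≡⟨ collect k n ⟩
    K G * n            ∎
    where
    open ≤-Reasoning
    collect : ∀ k n → k * n + k * n + n ≡ (k + k + 1) * n
    collect = solve-∀

  Dmat-controlled : Controlled 2 Dmat
  Dmat-controlled L {v} {C} {s} v≤ y = begin
    ∑ (λ x → v x * Dmat x y) (verts L)           ≤⟨ ∑-verts≤∑-lists L _ ⟩
    ∑ (λ x → v x * Dmat x y) (lists L)           ≤⟨ ∑-mono (lists L) diagonal ⟩
    ∑ (λ x → v y * deg * 𝟙 (x == y)) (lists L)   ≤⟨ ∑-*-≤ (v y * deg) (lists L) (count-== L y) ⟩
    v y * deg                                    ≤⟨ *-mono-≤ (v≤ y) degree≤K*n ⟩
    C * weight s h * (K G * n)                   ≡⟨ regroup C (weight s h) (K G) n ⟩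
    K G * C * (n * weight s h)                   ≤⟨ *-monoʳ-≤ (K G * C) (weight-loop s h) ⟩
    K G * C * weight (2 + s) h                   ≤⟨ *-monoˡ-≤ (weight (2 + s) h) (*-monoʳ-≤ (K G) C≤K*C) ⟩
    K G * (K G * C) * weight (2 + s) h           ∎
    where
    open ≤-Reasoning
    h = length y
    deg = k * n + k + 1
    regroup : ∀ C w K n → C * w * (K * n) ≡ K * C * (n * w)
    regroup = solve-∀
    C≤K*C : C ≤ K G * C
    C≤K*C = ≤-trans (≤-reflexive (sym (*-identityˡ C))) (*-monoˡ-≤ C (m≤n+m 1 (k + k)))
    diagonal : ∀ x → v x * Dmat x y ≤ v y * deg * 𝟙 (x == y)
    diagonal x with x == y in e | Dmat≤ x y
    ... | false | D≤ = ≤-trans (*-monoʳ-≤ (v x) D≤) (≤-trans (≤-reflexive (*-zeroʳ (v x))) z≤n)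
    ... | true | D≤ with ==-sound x y e
    ...   | refl = ≤-trans (*-monoʳ-≤ (v x) D≤) (≤-reflexive (unit (v x) deg))
      where
      unit : ∀ a d → a * (1 * d) ≡ a * d * 1
      unit = solve-∀

  A2mat-controlled : Controlled 2 A2mat
  A2mat-controlled L {v} {C} {s} v≤ y = begin
    ∑ (λ x → v x * A2mat x y) (verts L)
      ≤⟨ ∑-verts≤∑-lists L _ ⟩
    ∑ (λ x → v x * A2mat x y) (lists L)
      ≤⟨ ∑-lists-mono-short L _ _ (λ x |x|≤L → *-monoʳ-≤ (v x)
           (≤-trans (A2mat≤common x y) (common≤∑ (suc L) x y (s≤s |x|≤L)))) ⟩
    ∑ (λ x → v x * ∑ (λ z → 𝟙 (adj x z) * 𝟙 (adj z y)) (lists (suc L))) (lists L)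
      ≡⟨ ∑-cong (lists L) (λ x → sym (∑-*ˡ (v x) _ (lists (suc L)))) ⟩
    ∑ (λ x → ∑ (λ z → v x * (𝟙 (adj x z) * 𝟙 (adj z y))) (lists (suc L))) (lists L)
      ≡⟨ ∑-comm (λ x z → v x * (𝟙 (adj x z) * 𝟙 (adj z y))) (lists L) (lists (suc L)) ⟩
    ∑ (λ z → ∑ (λ x → v x * (𝟙 (adj x z) * 𝟙 (adj z y))) (lists L)) (lists (suc L))
      ≡⟨ ∑-cong (lists (suc L)) (λ z → trans (∑-cong (lists L) (λ x → sym (*-assoc (v x) _ _)))
                                              (∑-*ʳ (𝟙 (adj z y)) (λ x → v x * 𝟙 (adj x z)) (lists L))) ⟩
    ∑ (λ z → ∑ (λ x → v x * 𝟙 (adj x z)) (lists L) * 𝟙 (adj z y)) (lists (suc L))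
      ≤⟨ adjacency-flow (suc L) (adjacency-flow L v≤) y ⟩
    K G * (K G * C) * weight (2 + s) (length y) ∎
    where open ≤-Reasoning

  propagate-bounded : ∀ {X Y} → Controlled 2 X → Controlled 1 Y → ∀ w L {v C s} → Bounded v C s →
    Bounded (propagateℕ (verts L) v (map (choose X Y) w)) ((K G * K G) ^ length w * C) (budget w + s)
  propagate-bounded cX cY [] L {v} {C} {s} v≤ = subst (λ C' → Bounded v C' s) (sym (+-identityʳ C)) v≤
  propagate-bounded {X} {Y} cX cY (c ∷ w) L {v} {C} {s} v≤ =
    subst₂ (Bounded (propagateℕ (verts L) v (map (choose X Y) (c ∷ w))))
           (regroup ((K G * K G) ^ length w) (K G) C) (reorder (choose 2 1 c) (budget w) s)
           (propagate-bounded cX cY w L (controlled c L v≤))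
    where
    controlled : ∀ c → Controlled (choose 2 1 c) (choose X Y c)
    controlled true = cX
    controlled false = cY
    regroup : ∀ P K C → P * (K * (K * C)) ≡ K * K * P * C
    regroup = solve-∀
    reorder : ∀ a d s → d + (a + s) ≡ a + d + s
    reorder = solve-∀

  δ[]-bounded : Bounded δ[] 1 0
  δ[]-bounded [] = ≤-refl
  δ[]-bounded (_ ∷ _) = z≤n

  root-bound : ∀ {X Y} → Controlled 2 X → Controlled 1 Y → ∀ {w} L → false ∈ w →
    propagateℕ (verts L) δ[] (map (choose X Y) w) [] * n ≤ (K G * K G) ^ length w * n ^ length w
  root-bound {X} {Y} cX cY {w} L false∈w = begin
    P * n                       ≤⟨ *-monoˡ-≤ n (propagate-bounded cX cY w L δ[]-bounded []) ⟩
    C * 1 * n ^ e * n           ≡⟨ regroup C (n ^ e) n ⟩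
    C * n ^ suc e               ≤⟨ *-monoʳ-≤ C (^-monoʳ-≤ n e<|w|) ⟩
    C * n ^ length w            ∎
    where
    open ≤-Reasoning
    P = propagateℕ (verts L) δ[] (map (choose X Y) w) []
    C = (K G * K G) ^ length w
    e = ⌊ budget w + 0 /2⌋
    e<|w| : suc e ≤ length w
    e<|w| rewrite +-identityʳ (budget w) = ⌊budget/2⌋<length false∈w
    regroup : ∀ C a n → C * 1 * a * n ≡ C * (n * a)
    regroup = solve-∀

-- Rational estimates

toℚᵘ-ℕtoℚ : ∀ a → toℚᵘ (ℕtoℚ a) ≃ mkℚᵘ (ℤ.+ a) 0
toℚᵘ-ℕtoℚ a = ℚP.toℚᵘ-fromℚᵘ (mkℚᵘ (ℤ.+ a) 0)

ℕtoℚ-+ : ∀ a b → ℕtoℚ (a + b) ≡ ℕtoℚ a +ℚ ℕtoℚ b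
ℕtoℚ-+ a b = ℚP.toℚᵘ-injective (begin
  toℚᵘ (ℕtoℚ (a + b))                    ≈⟨ toℚᵘ-ℕtoℚ (a + b) ⟩
  mkℚᵘ (ℤ.+ (a + b)) 0                   ≈⟨ *≡* (trans (ℤP.*-identityʳ _) (trans (ℤP.pos-+ a b) (sym numerators))) ⟩
  mkℚᵘ (ℤ.+ a) 0 ℚᵘ.+ mkℚᵘ (ℤ.+ b) 0      ≈⟨ ℚᵘP.+-cong (toℚᵘ-ℕtoℚ a) (toℚᵘ-ℕtoℚ b) ⟨
  toℚᵘ (ℕtoℚ a) ℚᵘ.+ toℚᵘ (ℕtoℚ b)        ≈⟨ ℚP.toℚᵘ-homo-+ (ℕtoℚ a) (ℕtoℚ b) ⟨
  toℚᵘ (ℕtoℚ a +ℚ ℕtoℚ b)                ∎)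
  where
  open ℚᵘP.≃-Reasoning
  numerators : (ℤ.+ a ℤ.* ℤ.+ 1 ℤ.+ ℤ.+ b ℤ.* ℤ.+ 1) ℤ.* ℤ.+ 1 ≡ ℤ.+ a ℤ.+ ℤ.+ b
  numerators = trans (ℤP.*-identityʳ _) (cong₂ ℤ._+_ (ℤP.*-identityʳ (ℤ.+ a)) (ℤP.*-identityʳ (ℤ.+ b)))

ℕtoℚ-* : ∀ a b → ℕtoℚ (a * b) ≡ ℕtoℚ a *ℚ ℕtoℚ b
ℕtoℚ-* a b = ℚP.toℚᵘ-injective (begin
  toℚᵘ (ℕtoℚ (a * b))                    ≈⟨ toℚᵘ-ℕtoℚ (a * b) ⟩
  mkℚᵘ (ℤ.+ (a * b)) 0                   ≈⟨ *≡* (cong (ℤ._* ℤ.+ 1) (ℤP.pos-* a b)) ⟩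
  mkℚᵘ (ℤ.+ a) 0 ℚᵘ.* mkℚᵘ (ℤ.+ b) 0      ≈⟨ ℚᵘP.*-cong (toℚᵘ-ℕtoℚ a) (toℚᵘ-ℕtoℚ b) ⟨
  toℚᵘ (ℕtoℚ a) ℚᵘ.* toℚᵘ (ℕtoℚ b)        ≈⟨ ℚP.toℚᵘ-homo-* (ℕtoℚ a) (ℕtoℚ b) ⟨
  toℚᵘ (ℕtoℚ a *ℚ ℕtoℚ b)                ∎)
  where open ℚᵘP.≃-Reasoning

ℕtoℚ-mono-≤ : ∀ {a b} → a ≤ b → ℕtoℚ a ≤ℚ ℕtoℚ b
ℕtoℚ-mono-≤ {a} {b} a≤b = ℚP.toℚᵘ-cancel-≤ (begin
  toℚᵘ (ℕtoℚ a)    ≃⟨ toℚᵘ-ℕtoℚ a ⟩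
  mkℚᵘ (ℤ.+ a) 0   ≤⟨ *≤* (ℤP.*-monoʳ-≤-nonNeg (ℤ.+ 1) (ℤ.+≤+ a≤b)) ⟩
  mkℚᵘ (ℤ.+ b) 0   ≃⟨ toℚᵘ-ℕtoℚ b ⟨
  toℚᵘ (ℕtoℚ b)    ∎)
  where open ℚᵘP.≤-Reasoning

ℕtoℚ-nonNeg : ∀ a → 0ℚ ≤ℚ ℕtoℚ a
ℕtoℚ-nonNeg a = ℕtoℚ-mono-≤ {0} {a} z≤n

toℚᵘ-ℕtoℚ*inv : ∀ a m → toℚᵘ (ℕtoℚ a *ℚ inv (suc m)) ≃ mkℚᵘ (ℤ.+ a) m
toℚᵘ-ℕtoℚ*inv a m = begin
  toℚᵘ (ℕtoℚ a *ℚ inv (suc m))            ≈⟨ ℚP.toℚᵘ-homo-* (ℕtoℚ a) (inv (suc m)) ⟩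
  toℚᵘ (ℕtoℚ a) ℚᵘ.* toℚᵘ (inv (suc m))   ≈⟨ ℚᵘP.*-cong (toℚᵘ-ℕtoℚ a) (ℚP.toℚᵘ-fromℚᵘ (mkℚᵘ (ℤ.+ 1) m)) ⟩
  mkℚᵘ (ℤ.+ a) 0 ℚᵘ.* mkℚᵘ (ℤ.+ 1) m      ≈⟨ *≡* (trans (cong (ℤ._* ℤ.+ suc m) (ℤP.*-identityʳ (ℤ.+ a)))
                                                         (cong (λ d → ℤ.+ a ℤ.* ℤ.+ suc d) (sym (+-identityʳ m)))) ⟩
  mkℚᵘ (ℤ.+ a) m                          ∎
  where open ℚᵘP.≃-Reasoning

ℕtoℚ*inv≡1 : ∀ m → ℕtoℚ (suc m) *ℚ inv (suc m) ≡ 1ℚ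
ℕtoℚ*inv≡1 m = ℚP.toℚᵘ-injective (ℚᵘP.≃-trans (toℚᵘ-ℕtoℚ*inv (suc m) m) (*≡* (ℤP.*-comm (ℤ.+ suc m) (ℤ.+ 1))))

[p*q]*[r*s]≡[p*r]*[q*s] : ∀ p q r s → p *ℚ q *ℚ (r *ℚ s) ≡ p *ℚ r *ℚ (q *ℚ s)
[p*q]*[r*s]≡[p*r]*[q*s] = solve 4 (λ p q r s → p :* q :* (r :* s) := p :* r :* (q :* s)) refl
  where open +-*-Solver

invPow : ℕ → ℕ → ℚ
invPow n zero = 1ℚ
invPow n (suc l) = inv n *ℚ invPow n l

ℕtoℚ[n^l]*invPow≡1 : ∀ m l → ℕtoℚ (suc m ^ l) *ℚ invPow (suc m) l ≡ 1ℚ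
ℕtoℚ[n^l]*invPow≡1 m zero = ℚP.*-identityˡ 1ℚ
ℕtoℚ[n^l]*invPow≡1 m (suc l) = begin
  ℕtoℚ (n * n ^ l) *ℚ (inv n *ℚ I)          ≡⟨ cong (_*ℚ (inv n *ℚ I)) (ℕtoℚ-* n (n ^ l)) ⟩
  ℕtoℚ n *ℚ ℕtoℚ (n ^ l) *ℚ (inv n *ℚ I)    ≡⟨ [p*q]*[r*s]≡[p*r]*[q*s] (ℕtoℚ n) (ℕtoℚ (n ^ l)) (inv n) I ⟩
  ℕtoℚ n *ℚ inv n *ℚ (ℕtoℚ (n ^ l) *ℚ I)    ≡⟨ cong₂ _*ℚ_ (ℕtoℚ*inv≡1 m) (ℕtoℚ[n^l]*invPow≡1 m l) ⟩
  1ℚ *ℚ 1ℚ                                  ≡⟨ ℚP.*-identityˡ 1ℚ ⟩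
  1ℚ                                        ∎
  where
  open ≡-Reasoning
  n = suc m
  I = invPow n l

*-nonNeg : ∀ {p q} → 0ℚ ≤ℚ p → 0ℚ ≤ℚ q → 0ℚ ≤ℚ p *ℚ q
*-nonNeg {p} {q} 0≤p 0≤q =
  ℚP.nonNegative⁻¹ _ {{ℚP.nonNeg*nonNeg⇒nonNeg p {{ℚ.nonNegative 0≤p}} q {{ℚ.nonNegative 0≤q}}}}

inv-nonNeg : ∀ n → 0ℚ ≤ℚ inv n
inv-nonNeg zero = ℚP.≤-refl
inv-nonNeg (suc m) = ℚP.nonNegative⁻¹ _ {{ℚP.normalize-nonNeg 1 (suc m)}}

invPow-nonNeg : ∀ n l → 0ℚ ≤ℚ invPow n l
invPow-nonNeg n zero = ℕtoℚ-nonNeg 1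
invPow-nonNeg n (suc l) = *-nonNeg (inv-nonNeg n) (invPow-nonNeg n l)

ℕtoℚ*inv<ε : ∀ a (ε : ℚ) → 0ℚ <ℚ ε → ∀ m → a * ℚ.↧ₙ ε < suc m → ℕtoℚ a *ℚ inv (suc m) <ℚ ε
ℕtoℚ*inv<ε a (ℚ.mkℚ (ℤ.+ zero) _ _) (ℚ.*<* (ℤ.+<+ ())) m _
ℕtoℚ*inv<ε a (ℚ.mkℚ ℤ.-[1+ _ ] _ _) (ℚ.*<* ()) m _
ℕtoℚ*inv<ε a (ℚ.mkℚ (ℤ.+ suc p) d-1 _) _ m a*d<n =
  ℚP.toℚᵘ-cancel-< (ℚᵘP.<-respˡ-≃ (ℚᵘP.≃-sym (toℚᵘ-ℕtoℚ*inv a m)) (*<* cross-multiplied))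
  where
  cross-multiplied : ℤ.+ a ℤ.* ℤ.+ suc d-1 ℤ.< ℤ.+ suc p ℤ.* ℤ.+ suc m
  cross-multiplied = subst₂ ℤ._<_ (ℤP.pos-* a (suc d-1)) (ℤP.pos-* (suc p) (suc m))
    (ℤ.+<+ (<-≤-trans a*d<n (m≤n*m (suc m) (suc p))))

O[1/n]⇒TendsToZero : ∀ (f : ℕ → ℚ) C → (∀ m → 0ℚ ≤ℚ f (suc m)) → (∀ m → f (suc m) ≤ℚ ℕtoℚ C *ℚ inv (suc m)) →
  TendsToZero f
O[1/n]⇒TendsToZero f C f≥0 f≤C/n ε ε>0 = suc (C * ℚ.↧ₙ ε) , λ where
  (suc m) (s≤s N≤m) → subst (_<ℚ ε) (sym (ℚP.0≤p⇒∣p∣≡p (f≥0 m)))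
    (ℚP.≤-<-trans (f≤C/n m) (ℕtoℚ*inv<ε C ε ε>0 m (s≤s N≤m)))

ℕtoℚ*invPow≤ : ∀ P C m l → P * suc m ≤ C * suc m ^ l → ℕtoℚ P *ℚ invPow (suc m) l ≤ℚ ℕtoℚ C *ℚ inv (suc m)
ℕtoℚ*invPow≤ P C m l P*n≤C*n^l = begin
  ℕtoℚ P *ℚ I                                 ≡⟨ ℚP.*-identityʳ (ℕtoℚ P *ℚ I) ⟨
  ℕtoℚ P *ℚ I *ℚ 1ℚ                           ≡⟨ cong (ℕtoℚ P *ℚ I *ℚ_) (ℕtoℚ*inv≡1 m) ⟨
  ℕtoℚ P *ℚ I *ℚ (ℕtoℚ n *ℚ inv n)            ≡⟨ regroup (ℕtoℚ P) I (ℕtoℚ n) (inv n) ⟩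
  ℕtoℚ P *ℚ ℕtoℚ n *ℚ I *ℚ inv n              ≡⟨ cong (λ t → t *ℚ I *ℚ inv n) (ℕtoℚ-* P n) ⟨
  ℕtoℚ (P * n) *ℚ I *ℚ inv n                  ≤⟨ ℚP.*-monoʳ-≤-nonNeg (inv n) {{ℚ.nonNegative (inv-nonNeg n)}}
                                                   (ℚP.*-monoʳ-≤-nonNeg I {{ℚ.nonNegative (invPow-nonNeg n l)}}
                                                     (ℕtoℚ-mono-≤ P*n≤C*n^l)) ⟩
  ℕtoℚ (C * n ^ l) *ℚ I *ℚ inv n              ≡⟨ cong (λ t → t *ℚ I *ℚ inv n) (ℕtoℚ-* C (n ^ l)) ⟩
  ℕtoℚ C *ℚ ℕtoℚ (n ^ l) *ℚ I *ℚ inv n        ≡⟨ cong (_*ℚ inv n) (ℚP.*-assoc (ℕtoℚ C) _ I) ⟩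
  ℕtoℚ C *ℚ (ℕtoℚ (n ^ l) *ℚ I) *ℚ inv n      ≡⟨ cong (λ t → ℕtoℚ C *ℚ t *ℚ inv n) (ℕtoℚ[n^l]*invPow≡1 m l) ⟩
  ℕtoℚ C *ℚ 1ℚ *ℚ inv n                       ≡⟨ cong (_*ℚ inv n) (ℚP.*-identityʳ (ℕtoℚ C)) ⟩
  ℕtoℚ C *ℚ inv n                             ∎
  where
  open ℚP.≤-Reasoning
  n = suc m
  I = invPow n l
  regroup : ∀ a b c d → a *ℚ b *ℚ (c *ℚ d) ≡ a *ℚ c *ℚ b *ℚ d
  regroup = solve 4 (λ a b c d → a :* b :* (c :* d) := a :* c :* b :* d) refl
    where open +-*-Solver

-- The vacuum state

module VacuumState (G : RootedGraph) (n : ℕ) where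
  open FreePower G n
  open Moments G n
  open Enumeration G n using (δ[])

  sumℚ-cong : {f g : Word → ℚ} (xs : List Word) → (∀ x → f x ≡ g x) → sumℚ f xs ≡ sumℚ g xs
  sumℚ-cong [] f≗g = refl
  sumℚ-cong (x ∷ xs) f≗g = cong₂ _+ℚ_ (f≗g x) (sumℚ-cong xs f≗g)

  sumℚ-ℕtoℚ : (g : Word → ℕ) (c : ℚ) (xs : List Word) → sumℚ (λ x → ℕtoℚ (g x) *ℚ c) xs ≡ ℕtoℚ (∑ g xs) *ℚ c
  sumℚ-ℕtoℚ g c [] = sym (ℚP.*-zeroˡ c)
  sumℚ-ℕtoℚ g c (x ∷ xs) = begin
    ℕtoℚ (g x) *ℚ c +ℚ sumℚ (λ x → ℕtoℚ (g x) *ℚ c) xs  ≡⟨ cong (ℕtoℚ (g x) *ℚ c +ℚ_) (sumℚ-ℕtoℚ g c xs) ⟩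
    ℕtoℚ (g x) *ℚ c +ℚ ℕtoℚ (∑ g xs) *ℚ c              ≡⟨ ℚP.*-distribʳ-+ c (ℕtoℚ (g x)) (ℕtoℚ (∑ g xs)) ⟨
    (ℕtoℚ (g x) +ℚ ℕtoℚ (∑ g xs)) *ℚ c                 ≡⟨ cong (_*ℚ c) (ℕtoℚ-+ (g x) (∑ g xs)) ⟨
    ℕtoℚ (g x + ∑ g xs) *ℚ c                           ∎
    where open ≡-Reasoning

  propagate-cong : ∀ S Ms {v v' : Word → ℚ} → (∀ x → v x ≡ v' x) → ∀ y → propagate S v Ms y ≡ propagate S v' Ms y
  propagate-cong S [] v≗v' = v≗v'
  propagate-cong S (M ∷ Ms) v≗v' = propagate-cong S Ms (λ z → sumℚ-cong S (λ x → cong (_*ℚ M x z) (v≗v' x)))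

  propagate-scaled : ∀ S Ns (v : Word → ℕ) c y →
    propagate S (λ x → ℕtoℚ (v x) *ℚ c) (map scaled Ns) y ≡ ℕtoℚ (propagateℕ S v Ns y) *ℚ (c *ℚ invPow n (length Ns))
  propagate-scaled S [] v c y = cong (ℕtoℚ (v y) *ℚ_) (sym (ℚP.*-identityʳ c))
  propagate-scaled S (N ∷ Ns) v c y = begin
    propagate S (λ z → sumℚ (λ x → ℕtoℚ (v x) *ℚ c *ℚ scaled N x z) S) (map scaled Ns) y
      ≡⟨ propagate-cong S (map scaled Ns) one-step y ⟩
    propagate S (λ z → ℕtoℚ (vecMul S v N z) *ℚ (c *ℚ inv n)) (map scaled Ns) y
      ≡⟨ propagate-scaled S Ns (vecMul S v N) (c *ℚ inv n) y ⟩
    ℕtoℚ (propagateℕ S (vecMul S v N) Ns y) *ℚ (c *ℚ inv n *ℚ invPow n (length Ns))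
      ≡⟨ cong (ℕtoℚ (propagateℕ S (vecMul S v N) Ns y) *ℚ_) (ℚP.*-assoc c (inv n) (invPow n (length Ns))) ⟩
    ℕtoℚ (propagateℕ S (vecMul S v N) Ns y) *ℚ (c *ℚ invPow n (length (N ∷ Ns))) ∎
    where
    open ≡-Reasoning
    one-step : ∀ z → sumℚ (λ x → ℕtoℚ (v x) *ℚ c *ℚ scaled N x z) S ≡ ℕtoℚ (vecMul S v N z) *ℚ (c *ℚ inv n)
    one-step z = trans
      (sumℚ-cong S (λ x → trans ([p*q]*[r*s]≡[p*r]*[q*s] (ℕtoℚ (v x)) c (ℕtoℚ (N x z)) (inv n))
                                (cong (_*ℚ (c *ℚ inv n)) (sym (ℕtoℚ-* (v x) (N x z))))))
      (sumℚ-ℕtoℚ (λ x → v x * N x z) (c *ℚ inv n) S)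

  vacuum-scaled : ∀ S Ns → propagate S δe (map scaled Ns) [] ≡ ℕtoℚ (propagateℕ S δ[] Ns []) *ℚ invPow n (length Ns)
  vacuum-scaled S Ns = begin
    propagate S δe (map scaled Ns) []                           ≡⟨ propagate-cong S (map scaled Ns) δe≡δ[] [] ⟩
    propagate S (λ x → ℕtoℚ (δ[] x) *ℚ 1ℚ) (map scaled Ns) []  ≡⟨ propagate-scaled S Ns δ[] 1ℚ [] ⟩
    ℕtoℚ P *ℚ (1ℚ *ℚ invPow n (length Ns))                      ≡⟨ cong (ℕtoℚ P *ℚ_) (ℚP.*-identityˡ _) ⟩
    ℕtoℚ P *ℚ invPow n (length Ns)                              ∎
    where
    open ≡-Reasoning
    P = propagateℕ S δ[] Ns []
    δe≡δ[] : ∀ x → δe x ≡ ℕtoℚ (δ[] x) *ℚ 1ℚ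
    δe≡δ[] x with x == []
    ... | true = sym (ℚP.*-identityˡ 1ℚ)
    ... | false = sym (ℚP.*-zeroˡ 1ℚ)

map-choose : {A B : Set} (f : A → B) (a b : A) (w : List Bool) →
  map (choose (f a) (f b)) w ≡ map f (map (choose a b) w)
map-choose f a b w = trans (List.map-cong choose-∘ w) (List.map-∘ w)
  where
  choose-∘ : ∀ c → choose (f a) (f b) c ≡ f (choose a b c)
  choose-∘ true = refl
  choose-∘ false = refl

module MomentEstimate (G : RootedGraph) (m : ℕ) where
  open FreePower G (suc m)
  open Moments G (suc m)
  open Enumeration G (suc m) using (δ[])
  open Growth G m

  moment-estimate : ∀ {X Y} → Controlled 2 X → Controlled 1 Y → ∀ {w} → false ∈ w →
    0ℚ ≤ℚ φ₁ (map (choose (scaled X) (scaled Y)) w)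
    × φ₁ (map (choose (scaled X) (scaled Y)) w) ≤ℚ ℕtoℚ ((K G * K G) ^ length w) *ℚ inv n
  moment-estimate {X} {Y} cX cY {w} false∈w =
    subst (λ μ → 0ℚ ≤ℚ μ × μ ≤ℚ ℕtoℚ C *ℚ inv n) (sym φ₁≡)
      (*-nonNeg (ℕtoℚ-nonNeg P) (invPow-nonNeg n (length w)) ,
       ℕtoℚ*invPow≤ P C m (length w) (root-bound cX cY L false∈w))
    where
    open ≡-Reasoning
    C = (K G * K G) ^ length w
    Ms = map (choose (scaled X) (scaled Y)) w
    L = 2 * length Ms
    P = propagateℕ (verts L) δ[] (map (choose X Y) w) []
    φ₁≡ : φ₁ Ms ≡ ℕtoℚ P *ℚ invPow n (length w)
    φ₁≡ = begin
      propagate (verts L) δe Ms []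
        ≡⟨ cong (λ Ms′ → propagate (verts L) δe Ms′ []) (map-choose scaled X Y w) ⟩
      propagate (verts L) δe (map scaled (map (choose X Y) w)) []
        ≡⟨ VacuumState.vacuum-scaled G n (verts L) (map (choose X Y) w) ⟩
      ℕtoℚ P *ℚ invPow n (length (map (choose X Y) w))
        ≡⟨ cong (λ l → ℕtoℚ P *ℚ invPow n l) (List.length-map (choose X Y) w) ⟩
      ℕtoℚ P *ℚ invPow n (length w) ∎

mixedMomentsVanish : (G : RootedGraph) (X Y : (n : ℕ) → FreePower.Word G n → FreePower.Word G n → ℕ) →
  (∀ m → Growth.Controlled G m 2 (X (suc m))) → (∀ m → Growth.Controlled G m 1 (Y (suc m))) →
  MixedMomentsVanish G X Y
mixedMomentsVanish G X Y cX cY w _ false∈w = O[1/n]⇒TendsToZero _ ((K G * K G) ^ length w)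
  (λ m → proj₁ (MomentEstimate.moment-estimate G m (cX m) (cY m) false∈w))
  (λ m → proj₂ (MomentEstimate.moment-estimate G m (cX m) (cY m) false∈w))

corollary4p5 : (G : RootedGraph) → Connected G →
    MixedMomentsVanish G (λ n → FreePower.A2mat G n) (λ n → FreePower.Δmat G n)
    × MixedMomentsVanish G (λ n → FreePower.Dmat G n) (λ n → FreePower.Δmat G n)
corollary4p5 G _ =
  mixedMomentsVanish G (FreePower.A2mat G) (FreePower.Δmat G) (Growth.A2mat-controlled G) (Growth.Δmat-controlled G) ,
  mixedMomentsVanish G (FreePower.Dmat G) (FreePower.Δmat G) (Growth.Dmat-controlled G) (Growth.Δmat-controlled G)
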